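{- If a series–parallel graph $G$ contains $R_{3,2}$ as a substructure, then $G$ is not minimally $\frac12$-tough.
   Context: All graphs are finite and undirected; parallel edges allowed. For a graph $H$, $c(H)$ denotes its number of components. A set $S\subseteq V(G)$ is a cutset if $c(G-S)>1$. $G$ is $t$-tough if $|S|\ge t\cdot c(G-S)$ for every cutset $S$; $\tau(G)$ is the largest such $t$, with $\tau(K_n)=\infty$. $G$ is minimally $t$-tough if $\tau(G)=t$ and $\tau(G-e)<t$ for every edge $e$. A series–parallel graph $G(s,t)$ with terminals $s,t$ is either a single edge $st$, or is obtained from series–parallel graphs $G_1(s_1,t_1),\dots,G_k(s_k,t_k)$, $k\ge 2$, by a series join (identify $t_i$ with $s_{i+1}$, set $s=s_1$, $t=t_k$) or a parallel join (identify all $s_i$ into $s$ and all $t_i$ into $t$). The construction gives a rooted ordered tree $T_G$ (sp-tree): leaves are edges, internal nodes are series or parallel joins (children ordered as joined), with series and parallel nodes alternating along root-to-leaf paths. A substructure of $T_G$ rooted at a node $x$ consists of $x$ together with some of its children (consecutive ones if $x$ is a series node) and the complete subtrees below those children; only the root of a substructure may have further children not in it. $P_2$ is a series node with exactly two edge children. For $i\ge2$, $R_i$ is a parallel node with exactly $i$ children, each a $P_2$; $R_1$ is a single edge. For $i,j\ge 1$, $R_{i,j}$ is the substructure consisting of a series node having, as two consecutive children (in this order), an $R_i$ and an $R_j$ (the series join of $R_i$ and $R_j$). $G$ contains $R_{3,2}$ if $T_G$ has a substructure of this form. -}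

module Defs where

open import Data.Nat as ℕ using (ℕ)
open import Data.Integer using (+_)
open import Data.Rational using (ℚ; _/_; _*_; _≤_; _<_)
open import Data.Fin using (Fin)
open import Data.List using (List; []; _∷_; _++_; length; map; removeAt)
open import Data.List.Membership.Propositional using (_∈_; _∉_)
open import Data.List.Relation.Unary.All using (All)
open import Data.List.Relation.Unary.Any using (Any)
open import Data.List.Relation.Unary.Unique.Propositional using (Unique)
open import Data.Product using (Σ; ∃; _×_; _,_)
open import Data.Sum using (_⊎_; inj₁; inj₂)
open import Data.Empty using (⊥)
open import Data.Unit using (⊤)
open import Function.Bundles using (_⇔_)
open import Relation.Binary.PropositionalEquality using (_≡_)

-- Finite multigraphs (parallel edges allowed): a vertex type and an
-- edge list.  Only graphs with finitely many vertices arise below.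

record Graph : Set₁ where
  field
    V : Set
    E : List (V × V)
open Graph public

deleteEdge : (G : Graph) → Fin (length (E G)) → Graph
deleteEdge G e = record { V = V G ; E = removeAt (E G) e }

-- Walks in G - S : every vertex after the start avoids S
data Reach (G : Graph) (S : List (V G)) : V G → V G → Set where
  here : ∀ {u} → Reach G S u u
  step : ∀ {u w v} → ((u , w) ∈ E G ⊎ (w , u) ∈ E G) → w ∉ S →
         Reach G S w v → Reach G S u v

-- c(G - S) = k : the vertices outside S fall into exactly k
-- connected components of G - S
record Components (G : Graph) (S : List (V G)) (k : ℕ) : Set where
  field
    comp  : (v : V G) → v ∉ S → Fin k
    onto  : (i : Fin k) → Σ (V G) λ v → Σ (v ∉ S) λ p → comp v p ≡ i
    exact : (u v : V G) (pu : u ∉ S) (pv : v ∉ S) →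
            (comp u pu ≡ comp v pv) ⇔ Reach G S u v

ℕtoℚ : ℕ → ℚ
ℕtoℚ n = + n / 1

Tough : Graph → ℚ → Set
Tough G t = (S : List (V G)) → Unique S → (k : ℕ) → Components G S k →
            1 ℕ.< k → t * ℕtoℚ k ≤ ℕtoℚ (length S)

-- τ(G) = t : t is the largest value for which G is t-tough
-- (never holds for complete graphs, where τ = ∞)
ToughnessIs : Graph → ℚ → Set
ToughnessIs G t = Tough G t × ((t' : ℚ) → Tough G t' → t' ≤ t)

MinimallyTough : Graph → ℚ → Set
MinimallyTough G t =
  ToughnessIs G t ×
  ((e : Fin (length (E G))) → Σ ℚ λ t' → t' < t × ToughnessIs (deleteEdge G e) t')

data SPTree : Set where
  leaf : SPTree                      -- a single edge
  ser  : List SPTree → SPTree        -- series join, children in order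
  par  : List SPTree → SPTree

NotSer : SPTree → Set
NotSer (ser _) = ⊥
NotSer _       = ⊤

NotPar : SPTree → Set
NotPar (par _) = ⊥
NotPar _       = ⊤

data WF : SPTree → Set where
  wf-leaf : WF leaf
  wf-ser  : ∀ {cs} → 2 ℕ.≤ length cs → All (λ c → NotSer c × WF c) cs → WF (ser cs)
  wf-par  : ∀ {cs} → 2 ℕ.≤ length cs → All (λ c → NotPar c × WF c) cs → WF (par cs)

-- two-terminal graphs: vertices are s, t, or internal vertices
data Vtx (I : Set) : Set where
  src tgt : Vtx I
  int     : I → Vtx I

record TTGraph : Set₁ where
  field
    I  : Set
    Es : List (Vtx I × Vtx I)
open TTGraph public

mapE : {A B : Set} → (A → B) → List (A × A) → List (B × B)
mapE f = map (λ { (a , b) → (f a , f b) })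

edgeTT : TTGraph
edgeTT = record { I = ⊥ ; Es = (src , tgt) ∷ [] }

-- series join of two: t of the first identified with s of the second
-- (the new middle vertex is int (inj₂ (inj₂ tt)))
ser2 : TTGraph → TTGraph → TTGraph
ser2 G H = record { I = I G ⊎ (I H ⊎ ⊤)
                  ; Es = mapE f (Es G) ++ mapE g (Es H) }
  where
  mid : Vtx (I G ⊎ (I H ⊎ ⊤))
  mid = int (inj₂ (inj₂ _))
  f : Vtx (I G) → Vtx (I G ⊎ (I H ⊎ ⊤))
  f src = src
  f tgt = mid
  f (int i) = int (inj₁ i)
  g : Vtx (I H) → Vtx (I G ⊎ (I H ⊎ ⊤))
  g src = mid
  g tgt = tgt
  g (int j) = int (inj₂ (inj₁ j))

par2 : TTGraph → TTGraph → TTGraph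
par2 G H = record { I = I G ⊎ I H ; Es = mapE f (Es G) ++ mapE g (Es H) }
  where
  f : Vtx (I G) → Vtx (I G ⊎ I H)
  f src = src
  f tgt = tgt
  f (int i) = int (inj₁ i)
  g : Vtx (I H) → Vtx (I G ⊎ I H)
  g src = src
  g tgt = tgt
  g (int j) = int (inj₂ j)

mutual
  spGraph : SPTree → TTGraph
  spGraph leaf     = edgeTT
  spGraph (ser [])       = edgeTT   -- excluded by WF
  spGraph (ser (c ∷ cs)) = serList (spGraph c) cs
  spGraph (par [])       = edgeTT   -- excluded by WF
  spGraph (par (c ∷ cs)) = parList (spGraph c) cs

  serList : TTGraph → List SPTree → TTGraph
  serList G []       = G
  serList G (c ∷ cs) = ser2 G (serList (spGraph c) cs)

  parList : TTGraph → List SPTree → TTGraph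
  parList G []       = G
  parList G (c ∷ cs) = par2 G (parList (spGraph c) cs)

graphOf : SPTree → Graph
graphOf T = record { V = Vtx (I (spGraph T)) ; E = Es (spGraph T) }

P₂ : SPTree
P₂ = ser (leaf ∷ leaf ∷ [])

R₃ : SPTree
R₃ = par (P₂ ∷ P₂ ∷ P₂ ∷ [])

R₂ : SPTree
R₂ = par (P₂ ∷ P₂ ∷ [])

data ContainsR32 : SPTree → Set where
  atRoot : ∀ pre post → ContainsR32 (ser (pre ++ R₃ ∷ R₂ ∷ post))
  inSer  : ∀ {cs} → Any ContainsR32 cs → ContainsR32 (ser cs)
  inPar  : ∀ {cs} → Any ContainsR32 cs → ContainsR32 (par cs)

{-# OPTIONS --safe #-}

-- R₃,₂ supplies vertices a, b with three common neighbours x₁, x₂, x₃ of degree two, and a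
-- neighbour y of b of degree two whose other neighbour is c.  If G is ½-tough, so is G - x₁b,
-- hence τ(G - x₁b) is not below ½.  Let S be a cutset of G - x₁b with k components.
-- If x₁b meets S or lies inside one component, G - S has the same components and
-- ½-toughness of G gives k ≤ 2|S|.  Otherwise, if a ∉ S then x₂ ∈ S, and G - (S - x₂) has
-- at least k - 1 components; if a ∈ S then S′ = (S - {x₂, x₃, y}) + b isolates x₂ and x₃,
-- and G - S′ has at least k + 2 components, or k + 1 when y ∈ S (where |S′| ≤ |S|).  Either
-- way ½-toughness of G again yields k ≤ 2|S|.
--
-- Components are counted from below by labellings: surjective labels that are constant
-- along edges.  Components themselves exist once reachability is decidable, which may be
-- assumed because the bounds being proved are decidable.

module Submission where

open import Defs
open import Data.Rational using (½)
open import Relation.Nullary using (¬_)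

open import Data.Empty using (⊥; ⊥-elim)
open import Data.Unit using (⊤; tt)
import Data.Unit.Properties as ⊤
open import Data.Nat as ℕ using (ℕ; zero; suc; z≤n; s≤s; _≤?_)
import Data.Nat.Properties as ℕP
open import Data.Integer as ℤ using (+_)
import Data.Integer.Properties as ℤP
import Data.Rational as ℚ
import Data.Rational.Properties as ℚP
import Data.Rational.Unnormalised as ℚᵘ
import Data.Rational.Unnormalised.Properties as ℚᵘP
open import Data.Fin as Fin using (Fin; zero; suc; punchIn; punchOut)
import Data.Fin.Properties as FinP
open import Data.List using (List; []; _∷_; _++_; map; length; lookup; filter; removeAt)
open import Data.List.Properties using (length-filter; filter-notAll)
open import Data.List.Membership.Propositional using (_∈_; _∉_; find)
open import Data.List.Membership.Propositional.Properties
  using (∈-lookup; ∈-filter⁺; ∈-filter⁻; ∈-map⁺; ∈-map⁻; ∈-++⁺ˡ; ∈-++⁺ʳ; ∈-++⁻; ∈-∃++)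
open import Data.List.Relation.Unary.All as All using (All; []; _∷_)
open import Data.List.Relation.Unary.All.Properties using (¬Any⇒All¬; All¬⇒¬Any)
open import Data.List.Relation.Unary.AllPairs using (AllPairs; []; _∷_)
open import Data.List.Relation.Unary.Any as Any using (Any; here; there; index; any?)
open import Data.List.Relation.Unary.Any.Properties using (lookup-index)
open import Data.List.Relation.Unary.Unique.Propositional using (Unique)
import Data.List.Relation.Unary.Unique.Propositional.Properties as Unique
open import Data.Product using (Σ; ∃; ∃-syntax; _×_; _,_; proj₁; proj₂)
open import Data.Product.Properties using (,-injectiveˡ; ,-injectiveʳ)
open import Data.Sum as Sum using (_⊎_; inj₁; inj₂) renaming (swap to ⊎-swap)
import Data.Sum.Properties as Sum
open import Function using (_∘_)
open import Function.Bundles using (_⇔_; mk⇔; Equivalence)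
open import Relation.Binary.Definitions using (DecidableEquality)
open import Relation.Binary.PropositionalEquality
open import Relation.Nullary using (Dec; yes; no; ¬?)
open import Relation.Nullary.Decidable using (decidable-stable; ¬¬-excluded-middle; _×-dec_)
open import Relation.Nullary.Negation using (¬¬-map)

Adjacent : (G : Graph) → V G → V G → Set
Adjacent G u w = (u , w) ∈ E G ⊎ (w , u) ∈ E G

module _ {G : Graph} {S : List (V G)} where

  Reach-trans : ∀ {u v w} → Reach G S u v → Reach G S v w → Reach G S u w
  Reach-trans here q = q
  Reach-trans (step uw w∉S p) q = step uw w∉S (Reach-trans p q)

  Reach-sym : ∀ {u v} → u ∉ S → Reach G S u v → Reach G S v u
  Reach-sym u∉S here = here
  Reach-sym u∉S (step uw w∉S p) = Reach-trans (Reach-sym w∉S p) (step (⊎-swap uw) u∉S here)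

module _ {G : Graph} {S : List (V G)} {k : ℕ} (C : Components G S k) where
  open Components C

  comp-irrelevant : ∀ v (p q : v ∉ S) → comp v p ≡ comp v q
  comp-irrelevant v p q = Equivalence.from (exact v v p q) here

  comp-adjacent : ∀ {u w} (u∉S : u ∉ S) (w∉S : w ∉ S) → Adjacent G u w → comp u u∉S ≡ comp w w∉S
  comp-adjacent u∉S w∉S uw = Equivalence.from (exact _ _ u∉S w∉S) (step uw w∉S here)

record Labelling (G : Graph) (S : List (V G)) (m : ℕ) : Set where
  field
    label          : V G → Fin m
    label-adjacent : ∀ {u w} → u ∉ S → w ∉ S → Adjacent G u w → label u ≡ label w
    label-onto     : ∀ t → ∃[ v ] v ∉ S × label v ≡ t

  label-reach : ∀ {u v} → u ∉ S → Reach G S u v → label u ≡ label v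
  label-reach u∉S here = refl
  label-reach u∉S (step uw w∉S p) = trans (label-adjacent u∉S w∉S uw) (label-reach w∉S p)

  labels≤components : ∀ {k} → Components G S k → m ℕ.≤ k
  labels≤components {k} C = FinP.injective⇒≤ injective
    where
    open Components C
    f : Fin m → Fin k
    f t with label-onto t
    ... | v , v∉S , _ = comp v v∉S
    injective : ∀ {t t'} → f t ≡ f t' → t ≡ t'
    injective {t} {t'} eq with label-onto t | label-onto t'
    ... | v , v∉S , refl | v' , v'∉S , refl = label-reach v∉S (Equivalence.to (exact v v' v∉S v'∉S) eq)

module _ {G : Graph} (_≟_ : DecidableEquality (V G)) (S : List (V G))
         (reach? : ∀ u v → Dec (Reach G S u v)) where
  open import Data.List.Membership.DecPropositional _≟_ using (_∈?_)

  Apart : V G → V G → Set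
  Apart r r' = ¬ Reach G S r r'

  record Representatives (vs : List (V G)) : Set where
    field
      reps    : List (V G)
      outside : All (_∉ S) reps
      apart   : AllPairs Apart reps
      cover   : ∀ {v} → v ∉ S → v ∈ vs → Any (Reach G S v) reps

  module _ {v : V G} {vs : List (V G)} (R : Representatives vs) where
    open Representatives R

    keep : (v ∉ S → Any (Reach G S v) reps) → Representatives (v ∷ vs)
    keep cover-v = record
      { reps = reps ; outside = outside ; apart = apart
      ; cover = λ { u∉S (here refl) → cover-v u∉S ; u∉S (there m) → cover u∉S m } }

    new : v ∉ S → ¬ Any (Reach G S v) reps → Representatives (v ∷ vs)
    new v∉S v↛reps = record
      { reps = v ∷ reps ; outside = v∉S ∷ outside ; apart = ¬Any⇒All¬ reps v↛reps ∷ apart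
      ; cover = λ { u∉S (here refl) → here here ; u∉S (there m) → there (cover u∉S m) } }

    extend : Representatives (v ∷ vs)
    extend with v ∈? S | any? (reach? v) reps
    ... | yes v∈S | _       = keep (λ v∉S → ⊥-elim (v∉S v∈S))
    ... | no _    | yes v→r = keep (λ _ → v→r)
    ... | no v∉S  | no v↛r  = new v∉S v↛r

  representatives : ∀ vs → Representatives vs
  representatives []       = record { reps = [] ; outside = [] ; apart = [] ; cover = λ _ () }
  representatives (v ∷ vs) = extend (representatives vs)

  index-unique : ∀ {rs u w} → AllPairs Apart rs → u ∉ S → w ∉ S → Reach G S u w →
                 (p : Any (Reach G S u) rs) (q : Any (Reach G S w) rs) → index p ≡ index q
  index-unique _ _ _ _ (here _) (here _) = refl
  index-unique (r↮ ∷ _) u∉S _ u→w (here u→r) (there q) =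
    ⊥-elim (All¬⇒¬Any r↮ (Any.map (Reach-trans (Reach-trans (Reach-sym u∉S u→r) u→w)) q))
  index-unique (r↮ ∷ _) u∉S w∉S u→w (there p) (here w→r) =
    ⊥-elim (All¬⇒¬Any r↮ (Any.map (Reach-trans (Reach-trans (Reach-sym w∉S w→r) (Reach-sym u∉S u→w))) p))
  index-unique (_ ∷ apart) u∉S w∉S u→w (there p) (there q) = cong suc (index-unique apart u∉S w∉S u→w p q)

  reach-lookup : ∀ rs i → Σ (Any (Reach G S (lookup rs i)) rs) λ p → index p ≡ i
  reach-lookup (r ∷ rs) zero = here here , refl
  reach-lookup (r ∷ rs) (suc i) with p , p≡i ← reach-lookup rs i = there p , cong suc p≡i

  components : (vs : List (V G)) → (∀ v → v ∈ vs) → ∃ (Components G S)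
  components vs complete = length reps , record { comp = comp ; onto = onto ; exact = exact }
    where
    open Representatives (representatives vs)
    cover′ : ∀ {v} → v ∉ S → Any (Reach G S v) reps
    cover′ v∉S = cover v∉S (complete _)
    comp : (v : V G) → v ∉ S → Fin (length reps)
    comp v v∉S = index (cover′ v∉S)
    onto : ∀ i → ∃[ v ] Σ (v ∉ S) λ v∉S → comp v v∉S ≡ i
    onto i with p , p≡i ← reach-lookup reps i =
      _ , r∉S , trans (index-unique apart r∉S r∉S here (cover′ r∉S) p) p≡i
      where r∉S = All.lookup outside (∈-lookup i)
    exact : ∀ u v (u∉S : u ∉ S) (v∉S : v ∉ S) → (comp u u∉S ≡ comp v v∉S) ⇔ Reach G S u v
    exact u v u∉S v∉S = mk⇔
      (λ eq → Reach-trans (lookup-index (cover′ u∉S))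
                (Reach-sym v∉S (subst (Reach G S v ∘ lookup reps) (sym eq) (lookup-index (cover′ v∉S)))))
      (λ u→v → index-unique apart u∉S v∉S u→v (cover′ u∉S) (cover′ v∉S))

-- Finiteness and ½-toughness

record Finite (A : Set) : Set where
  field
    _≟_      : DecidableEquality A
    elements : List A
    complete : ∀ a → a ∈ elements

¬¬-All : ∀ {A : Set} {P : A → Set} xs → (∀ a → ¬ ¬ P a) → ¬ ¬ All P xs
¬¬-All []       _   k = k []
¬¬-All (x ∷ xs) ¬¬P k = ¬¬P x λ px → ¬¬-All xs ¬¬P λ pxs → k (px ∷ pxs)

module _ {A : Set} (finite : Finite A) where
  open Finite finite

  ¬¬-∀ : {P : A → Set} → (∀ a → ¬ ¬ P a) → ¬ ¬ (∀ a → P a)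
  ¬¬-∀ ¬¬P = ¬¬-map (λ all a → All.lookup all (complete a)) (¬¬-All elements ¬¬P)

½*ℕtoℚ≤ℕtoℚ⇔ : ∀ k s → ½ ℚ.* ℕtoℚ k ℚ.≤ ℕtoℚ s ⇔ k ℕ.≤ s ℕ.* 2
½*ℕtoℚ≤ℕtoℚ⇔ k s = mk⇔
  (λ h → ℤP.drop‿+≤+ (subst₂ ℤ._≤_ k≡ s*2≡ (ℚᵘP.drop-*≤* (≤ᵘ-to (ℚP.toℚᵘ-mono-≤ h)))))
  (λ h → ℚP.toℚᵘ-cancel-≤ (≤ᵘ-from (ℚᵘ.*≤* (subst₂ ℤ._≤_ (sym k≡) (sym s*2≡) (ℤ.+≤+ h)))))
  where
  half-k : ℚᵘ.ℚᵘ
  half-k = ℚ.toℚᵘ ½ ℚᵘ.* ℚᵘ.mkℚᵘ (+ k) 0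
  -- ℕtoℚ n is by definition fromℚᵘ (mkℚᵘ (+ n) 0)
  lhs : ℚ.toℚᵘ (½ ℚ.* ℕtoℚ k) ℚᵘ.≃ half-k
  lhs = ℚᵘP.≃-trans (ℚP.toℚᵘ-homo-* ½ (ℕtoℚ k)) (ℚᵘP.*-congˡ {ℚ.toℚᵘ ½} (ℚP.toℚᵘ-fromℚᵘ _))
  rhs : ℚ.toℚᵘ (ℕtoℚ s) ℚᵘ.≃ ℚᵘ.mkℚᵘ (+ s) 0
  rhs = ℚP.toℚᵘ-fromℚᵘ _
  ≤ᵘ-to : ℚ.toℚᵘ (½ ℚ.* ℕtoℚ k) ℚᵘ.≤ ℚ.toℚᵘ (ℕtoℚ s) → half-k ℚᵘ.≤ ℚᵘ.mkℚᵘ (+ s) 0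
  ≤ᵘ-to = ℚᵘP.≤-respˡ-≃ lhs ∘ ℚᵘP.≤-respʳ-≃ rhs
  ≤ᵘ-from : half-k ℚᵘ.≤ ℚᵘ.mkℚᵘ (+ s) 0 → ℚ.toℚᵘ (½ ℚ.* ℕtoℚ k) ℚᵘ.≤ ℚ.toℚᵘ (ℕtoℚ s)
  ≤ᵘ-from = ℚᵘP.≤-respˡ-≃ (ℚᵘP.≃-sym lhs) ∘ ℚᵘP.≤-respʳ-≃ (ℚᵘP.≃-sym rhs)
  k≡ : ℚᵘ.↥ half-k ℤ.* + 1 ≡ + k
  k≡ = trans (ℤP.*-identityʳ _) (ℤP.*-identityˡ (+ k))
  s*2≡ : + s ℤ.* ℚᵘ.↧ half-k ≡ + (s ℕ.* 2)
  s*2≡ = sym (ℤP.pos-* s 2)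

HalfTough : Graph → Set
HalfTough G = (S : List (V G)) → Unique S → (k : ℕ) → Components G S k → 1 ℕ.< k → k ℕ.≤ length S ℕ.* 2

Tough½⇔HalfTough : ∀ G → Tough G ½ ⇔ HalfTough G
Tough½⇔HalfTough G = mk⇔
  (λ tough S U k C 1<k → Equivalence.to (½*ℕtoℚ≤ℕtoℚ⇔ k (length S)) (tough S U k C 1<k))
  (λ bound S U k C 1<k → Equivalence.from (½*ℕtoℚ≤ℕtoℚ⇔ k (length S)) (bound S U k C 1<k))

module _ {G : Graph} (finite : Finite (V G)) (tough : HalfTough G) where
  open Finite finite

  labelling-bound : ∀ {S m} → Unique S → Labelling G S m → 1 ℕ.< m → m ℕ.≤ length S ℕ.* 2
  labelling-bound {S} {m} U L 1<m =
    decidable-stable (m ≤? length S ℕ.* 2) (¬¬-map bound reach-decidable)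
    where
    reach-decidable : ¬ ¬ (∀ u v → Dec (Reach G S u v))
    reach-decidable = ¬¬-∀ finite λ u → ¬¬-∀ finite λ v → ¬¬-excluded-middle
    bound : (∀ u v → Dec (Reach G S u v)) → m ℕ.≤ length S ℕ.* 2
    bound reach? with k , C ← components _≟_ S reach? elements complete =
      ℕP.≤-trans m≤k (tough S U k C (ℕP.<-≤-trans 1<m m≤k))
      where m≤k = Labelling.labels≤components L C

-- Deleting the edge x₁b

module _ {n : ℕ} {i j : Fin (suc n)} (i≢j : i ≢ j) where

  identify : Fin (suc n) → Fin n
  identify d with d Fin.≟ j
  ... | yes _   = punchOut (≢-sym i≢j)
  ... | no d≢j  = punchOut (≢-sym d≢j)

  identify-j : identify j ≡ identify i
  identify-j with j Fin.≟ j | i Fin.≟ j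
  ... | no j≢j | _       = ⊥-elim (j≢j refl)
  ... | yes _  | yes i≡j = ⊥-elim (i≢j i≡j)
  ... | yes _  | no _    = FinP.punchOut-cong j refl

  identify-punchIn : ∀ t → identify (punchIn j t) ≡ t
  identify-punchIn t with punchIn j t Fin.≟ j
  ... | yes eq = ⊥-elim (FinP.punchInᵢ≢i j t eq)
  ... | no _   = trans (FinP.punchOut-cong j refl) (FinP.punchOut-punchIn j)

suc≤*2 : ∀ {n s′ s} → s′ ℕ.< s → (1 ℕ.< n → n ℕ.≤ s′ ℕ.* 2) → suc n ℕ.≤ s ℕ.* 2
suc≤*2 {zero}        (s≤s _) _     = s≤s z≤n
suc≤*2 {suc zero}    (s≤s _) _     = s≤s (s≤s z≤n)
suc≤*2 {suc (suc n)} s′<s    bound =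
  ℕP.≤-trans (s≤s (bound (s≤s (s≤s z≤n)))) (ℕP.≤-trans (ℕP.n≤1+n _) (ℕP.*-monoˡ-≤ 2 s′<s))

∈-removeAt⁺ : ∀ {A : Set} {x y : A} {xs} (x∈xs : x ∈ xs) → y ∈ xs → y ≡ x ⊎ y ∈ removeAt xs (index x∈xs)
∈-removeAt⁺ (here refl)  (here y≡x)   = inj₁ y≡x
∈-removeAt⁺ (here refl)  (there y∈xs) = inj₂ y∈xs
∈-removeAt⁺ (there x∈xs) (here y≡z)   = inj₂ (here y≡z)
∈-removeAt⁺ (there x∈xs) (there y∈xs) = Sum.map₂ there (∈-removeAt⁺ x∈xs y∈xs)

module _ {G : Graph} {x y : V G} (xy : (x , y) ∈ E G) where

  ∈-deleteEdge : ∀ {u w} → (u , w) ∈ E G → u ≢ x → (u , w) ∈ E (deleteEdge G (index xy))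
  ∈-deleteEdge uw u≢x with ∈-removeAt⁺ xy uw
  ... | inj₁ refl = ⊥-elim (u≢x refl)
  ... | inj₂ uw⁻  = uw⁻

  adjacent-deleteEdge : ∀ {u w} → Adjacent G u w →
                        Adjacent (deleteEdge G (index xy)) u w ⊎ (u ≡ x × w ≡ y ⊎ u ≡ y × w ≡ x)
  adjacent-deleteEdge (inj₁ uw) with ∈-removeAt⁺ xy uw
  ... | inj₁ refl = inj₂ (inj₁ (refl , refl))
  ... | inj₂ uw⁻  = inj₁ (inj₁ uw⁻)
  adjacent-deleteEdge (inj₂ wu) with ∈-removeAt⁺ xy wu
  ... | inj₁ refl = inj₂ (inj₂ (refl , refl))
  ... | inj₂ wu⁻  = inj₁ (inj₂ wu⁻)

module Component {H : Graph} (_≟_ : DecidableEquality (V H)) {S : List (V H)} {k : ℕ}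
                 (C : Components H S k) where
  open Components C
  open import Data.List.Membership.DecPropositional _≟_ using (_∈?_)

  component : Fin k → V H → Fin k
  component d v with v ∈? S
  ... | yes _   = d
  ... | no v∉S  = comp v v∉S

  component-∉ : ∀ d {v} (v∉S : v ∉ S) → component d v ≡ comp v v∉S
  component-∉ d {v} v∉S with v ∈? S
  ... | yes v∈S  = ⊥-elim (v∉S v∈S)
  ... | no v∉S′  = comp-irrelevant C v v∉S′ v∉S

  component-∈ : ∀ d {v} → v ∈ S → component d v ≡ d
  component-∈ d {v} v∈S with v ∈? S
  ... | yes _   = refl
  ... | no v∉S  = ⊥-elim (v∉S v∈S)

  component-≡ : ∀ d {u w} (u∉S : u ∉ S) (w∉S : w ∉ S) → comp u u∉S ≡ comp w w∉S →
                component d u ≡ component d w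
  component-≡ d u∉S w∉S eq = trans (component-∉ d u∉S) (trans eq (sym (component-∉ d w∉S)))

  component-onto : ∀ d t → ∃[ v ] v ∉ S × component d v ≡ t
  component-onto d t with v , v∉S , eq ← onto t = v , v∉S , trans (component-∉ d v∉S) eq

module _ {G : Graph} (_≟_ : DecidableEquality (V G)) {x y : V G} (xy : (x , y) ∈ E G)
         {S : List (V G)} {n : ℕ} (C : Components (deleteEdge G (index xy)) S (suc n)) where
  open Components C
  open Component _≟_ C

  deleteEdge-labelling : (∀ x∉S y∉S → comp x x∉S ≡ comp y y∉S) → Labelling G S (suc n)
  deleteEdge-labelling x~y = record
    { label = component zero ; label-adjacent = adjacent ; label-onto = component-onto zero }
    where
    adjacent : ∀ {u w} → u ∉ S → w ∉ S → Adjacent G u w → component zero u ≡ component zero w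
    adjacent u∉S w∉S uw with adjacent-deleteEdge xy uw
    ... | inj₁ uw⁻                  = component-≡ zero u∉S w∉S (comp-adjacent C u∉S w∉S uw⁻)
    ... | inj₂ (inj₁ (refl , refl)) = component-≡ zero u∉S w∉S (x~y u∉S w∉S)
    ... | inj₂ (inj₂ (refl , refl)) = component-≡ zero u∉S w∉S (sym (x~y w∉S u∉S))

record Link (G : Graph) (p v q : V G) : Set where
  field
    edge₁      : (p , v) ∈ E G
    edge₂      : (v , q) ∈ E G
    neighbours : ∀ {w} → Adjacent G v w → w ≡ p ⊎ w ≡ q

record Distinct {A : Set} (a b x₁ x₂ x₃ y c : A) : Set where
  field
    a≢x₁ : a ≢ x₁
    a≢x₂ : a ≢ x₂
    a≢x₃ : a ≢ x₃
    a≢y  : a ≢ y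
    b≢x₁ : b ≢ x₁
    b≢x₂ : b ≢ x₂
    b≢x₃ : b ≢ x₃
    b≢y  : b ≢ y
    x₁≢x₂ : x₁ ≢ x₂
    x₁≢x₃ : x₁ ≢ x₃
    x₂≢x₃ : x₂ ≢ x₃
    x₂≢y  : x₂ ≢ y
    x₂≢c  : x₂ ≢ c
    x₃≢y  : x₃ ≢ y
    x₃≢c  : x₃ ≢ c
    y≢c   : y ≢ c

unique⇒distinct : ∀ {A : Set} {a b x₁ x₂ x₃ y c : A} →
                  Unique (a ∷ b ∷ x₁ ∷ x₂ ∷ x₃ ∷ y ∷ c ∷ []) → Distinct a b x₁ x₂ x₃ y c
unique⇒distinct ((_ ∷ a≢x₁ ∷ a≢x₂ ∷ a≢x₃ ∷ a≢y ∷ _ ∷ []) ∷ (b≢x₁ ∷ b≢x₂ ∷ b≢x₃ ∷ b≢y ∷ _ ∷ []) ∷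
                 (x₁≢x₂ ∷ x₁≢x₃ ∷ _ ∷ _ ∷ []) ∷ (x₂≢x₃ ∷ x₂≢y ∷ x₂≢c ∷ []) ∷ (x₃≢y ∷ x₃≢c ∷ []) ∷
                 (y≢c ∷ []) ∷ [] ∷ []) =
  record { a≢x₁ = a≢x₁ ; a≢x₂ = a≢x₂ ; a≢x₃ = a≢x₃ ; a≢y = a≢y ; b≢x₁ = b≢x₁ ; b≢x₂ = b≢x₂
         ; b≢x₃ = b≢x₃ ; b≢y = b≢y ; x₁≢x₂ = x₁≢x₂ ; x₁≢x₃ = x₁≢x₃ ; x₂≢x₃ = x₂≢x₃ ; x₂≢y = x₂≢y
         ; x₂≢c = x₂≢c ; x₃≢y = x₃≢y ; x₃≢c = x₃≢c ; y≢c = y≢c }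

record Pattern (G : Graph) : Set where
  field
    a b x₁ x₂ x₃ y c : V G
    link₁    : Link G a x₁ b
    link₂    : Link G a x₂ b
    link₃    : Link G a x₃ b
    link-y   : Link G b y c
    distinct : Unique (a ∷ b ∷ x₁ ∷ x₂ ∷ x₃ ∷ y ∷ c ∷ [])

module _ {G : Graph} (finite : Finite (V G)) (P : Pattern G) where
  open Finite finite
  open Pattern P
  open Distinct (unique⇒distinct distinct)
  open import Data.List.Membership.DecPropositional _≟_ using (_∈?_)

  x₁b : (x₁ , b) ∈ E G
  x₁b = Link.edge₂ link₁

  G⁻ : Graph
  G⁻ = deleteEdge G (index x₁b)

  module Cut (tough : HalfTough G) {S : List (V G)} (U : Unique S) {n : ℕ}
             (C : Components G⁻ S (suc n)) where
    open Components C
    open Component _≟_ C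

    a–x₁ : Adjacent G⁻ a x₁
    a–x₁ = inj₁ (∈-deleteEdge x₁b (Link.edge₁ link₁) a≢x₁)

    a–x₂ : Adjacent G⁻ a x₂
    a–x₂ = inj₁ (∈-deleteEdge x₁b (Link.edge₁ link₂) a≢x₁)

    x₂–b : Adjacent G⁻ x₂ b
    x₂–b = inj₁ (∈-deleteEdge x₁b (Link.edge₂ link₂) (≢-sym x₁≢x₂))

    x₃–b : Adjacent G⁻ x₃ b
    x₃–b = inj₁ (∈-deleteEdge x₁b (Link.edge₂ link₃) (≢-sym x₁≢x₃))

    y–b : Adjacent G⁻ y b
    y–b = ⊎-swap (inj₁ (∈-deleteEdge x₁b (Link.edge₁ link-y) b≢x₁))

    joined-bound : 1 ℕ.< suc n → (∀ x₁∉S b∉S → comp x₁ x₁∉S ≡ comp b b∉S) → suc n ℕ.≤ length S ℕ.* 2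
    joined-bound 1<k x₁~b = labelling-bound finite tough U (deleteEdge-labelling _≟_ x₁b C x₁~b) 1<k

    module Separated (a∉S : a ∉ S) (b∉S : b ∉ S) (i≢j : comp a a∉S ≢ comp b b∉S) where
      i j : Fin (suc n)
      i = comp a a∉S
      j = comp b b∉S

      x₂∈S : x₂ ∈ S
      x₂∈S = decidable-stable (x₂ ∈? S) λ x₂∉S →
        i≢j (trans (comp-adjacent C a∉S x₂∉S a–x₂) (comp-adjacent C x₂∉S b∉S x₂–b))

      S′ : List (V G)
      S′ = filter (λ v → ¬? (v ≟ x₂)) S

      outside : ∀ {v} → v ∉ S′ → v ≢ x₂ → v ∉ S
      outside v∉S′ v≢x₂ v∈S = v∉S′ (∈-filter⁺ _ v∈S v≢x₂)

      -- the default i labels the vertices of S; of these only x₂ lies outside S′, next to a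
      label : V G → Fin n
      label = identify i≢j ∘ component i

      label-outside : ∀ {v} (v∉S : v ∉ S) → label v ≡ identify i≢j (comp v v∉S)
      label-outside v∉S = cong (identify i≢j) (component-∉ i v∉S)

      label-b : label b ≡ identify i≢j i
      label-b = trans (label-outside b∉S) (identify-j i≢j)

      label-x₁ : label x₁ ≡ identify i≢j i
      label-x₁ = cong (identify i≢j) (component-x₁ (x₁ ∈? S))
        where
        component-x₁ : Dec (x₁ ∈ S) → component i x₁ ≡ i
        component-x₁ (yes x₁∈S) = component-∈ i x₁∈S
        component-x₁ (no x₁∉S)  = trans (component-∉ i x₁∉S) (sym (comp-adjacent C a∉S x₁∉S a–x₁))

      label-x₂-neighbour : ∀ {w} → Adjacent G x₂ w → label x₂ ≡ label w
      label-x₂-neighbour x₂w with Link.neighbours link₂ x₂w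
      ... | inj₁ refl = cong (identify i≢j) (trans (component-∈ i x₂∈S) (sym (component-∉ i a∉S)))
      ... | inj₂ refl = trans (cong (identify i≢j) (component-∈ i x₂∈S)) (sym label-b)

      label-adjacent : ∀ {u w} → u ∉ S′ → w ∉ S′ → Adjacent G u w → label u ≡ label w
      label-adjacent {u} {w} u∉S′ w∉S′ uw with u ≟ x₂ | w ≟ x₂
      ... | yes refl | _        = label-x₂-neighbour uw
      ... | no _     | yes refl = sym (label-x₂-neighbour (⊎-swap uw))
      ... | no u≢x₂  | no w≢x₂ with adjacent-deleteEdge x₁b uw
      ...   | inj₁ uw⁻ = trans (label-outside u∉S)
                         (trans (cong (identify i≢j) (comp-adjacent C u∉S w∉S uw⁻)) (sym (label-outside w∉S)))
        where
        u∉S = outside u∉S′ u≢x₂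
        w∉S = outside w∉S′ w≢x₂
      ...   | inj₂ (inj₁ (refl , refl)) = trans label-x₁ (sym label-b)
      ...   | inj₂ (inj₂ (refl , refl)) = trans label-b (sym label-x₁)

      label-onto : ∀ t → ∃[ v ] v ∉ S′ × label v ≡ t
      label-onto t with v , v∉S , eq ← onto (punchIn j t) =
        v , v∉S ∘ proj₁ ∘ ∈-filter⁻ _ ,
        trans (label-outside v∉S) (trans (cong (identify i≢j) eq) (identify-punchIn i≢j t))

      bound : suc n ℕ.≤ length S ℕ.* 2
      bound = suc≤*2 (filter-notAll _ S (Any.map (λ x₂≡v v≢x₂ → v≢x₂ (sym x₂≡v)) x₂∈S))
                     (labelling-bound finite tough (Unique.filter⁺ _ U)
                        record { label = label ; label-adjacent = label-adjacent ; label-onto = label-onto })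

    module CutAtA (a∈S : a ∈ S) (b∉S : b ∉ S) where
      j : Fin (suc n)
      j = comp b b∉S

      Kept : V G → Set
      Kept v = v ≢ x₂ × v ≢ x₃ × v ≢ y

      kept? : ∀ v → Dec (Kept v)
      kept? v = ¬? (v ≟ x₂) ×-dec ¬? (v ≟ x₃) ×-dec ¬? (v ≟ y)

      S′ : List (V G)
      S′ = b ∷ filter kept? S

      unique-S′ : Unique S′
      unique-S′ = ¬Any⇒All¬ _ (b∉S ∘ proj₁ ∘ ∈-filter⁻ kept? {xs = S}) ∷ Unique.filter⁺ kept? U

      outside : ∀ {v} → v ∉ S′ → Kept v → v ∉ S
      outside v∉S′ kept v∈S = v∉S′ (there (∈-filter⁺ kept? v∈S kept))

      a∈S′ : a ∈ S′
      a∈S′ = there (∈-filter⁺ kept? a∈S (a≢x₂ , a≢x₃ , a≢y))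

      x₂∉S′ : x₂ ∉ S′
      x₂∉S′ (here x₂≡b) = b≢x₂ (sym x₂≡b)
      x₂∉S′ (there m)   = proj₁ (proj₂ (∈-filter⁻ kept? {xs = S} m)) refl

      x₃∉S′ : x₃ ∉ S′
      x₃∉S′ (here x₃≡b) = b≢x₃ (sym x₃≡b)
      x₃∉S′ (there m)   = proj₁ (proj₂ (proj₂ (∈-filter⁻ kept? {xs = S} m))) refl

      link-isolated : ∀ {x u w} → Link G a x b → w ∉ S′ → Adjacent G u w → u ≢ x
      link-isolated link w∉S′ uw refl with Link.neighbours link uw
      ... | inj₁ refl = w∉S′ a∈S′
      ... | inj₂ refl = w∉S′ (here refl)

      comp-adjacent-outside : ∀ {u w} (u∉S : u ∉ S) (w∉S : w ∉ S) → u ∉ S′ → w ∉ S′ → Adjacent G u w →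
                     comp u u∉S ≡ comp w w∉S
      comp-adjacent-outside u∉S w∉S u∉S′ w∉S′ uw with adjacent-deleteEdge x₁b uw
      ... | inj₁ uw⁻                 = comp-adjacent C u∉S w∉S uw⁻
      ... | inj₂ (inj₁ (_ , refl))   = ⊥-elim (w∉S′ (here refl))
      ... | inj₂ (inj₂ (refl , _))   = ⊥-elim (u∉S′ (here refl))

      off-b-component : ∀ {v} (v∉S : v ∉ S) → comp v v∉S ≢ j → v ∉ S′ × v ≢ x₂ × v ≢ x₃
      off-b-component {v} v∉S v≁b = v∉S′ , v≢x₂ , v≢x₃
        where
        v∉S′ : v ∉ S′
        v∉S′ (here refl) = v≁b (comp-irrelevant C b v∉S b∉S)
        v∉S′ (there m)   = v∉S (proj₁ (∈-filter⁻ kept? {xs = S} m))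
        v≢x₂ : v ≢ x₂
        v≢x₂ refl = v≁b (comp-adjacent C v∉S b∉S x₂–b)
        v≢x₃ : v ≢ x₃
        v≢x₃ refl = v≁b (comp-adjacent C v∉S b∉S x₃–b)

      module KeepY (y∉S : y ∉ S) where
        label : V G → Fin (suc (suc (suc n)))
        label v with v ≟ x₂ | v ≟ x₃
        ... | yes _ | _     = zero
        ... | no _  | yes _ = suc zero
        ... | no _  | no _  = suc (suc (component zero v))

        label-x₂ : label x₂ ≡ zero
        label-x₂ with x₂ ≟ x₂
        ... | yes _    = refl
        ... | no x₂≢x₂ = ⊥-elim (x₂≢x₂ refl)

        label-x₃ : label x₃ ≡ suc zero
        label-x₃ with x₃ ≟ x₂ | x₃ ≟ x₃
        ... | yes x₃≡x₂ | _        = ⊥-elim (x₂≢x₃ (sym x₃≡x₂))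
        ... | no _      | yes _    = refl
        ... | no _      | no x₃≢x₃ = ⊥-elim (x₃≢x₃ refl)

        label-other : ∀ {v} → v ≢ x₂ → v ≢ x₃ → label v ≡ suc (suc (component zero v))
        label-other {v} v≢x₂ v≢x₃ with v ≟ x₂ | v ≟ x₃
        ... | yes v≡x₂ | _        = ⊥-elim (v≢x₂ v≡x₂)
        ... | no _     | yes v≡x₃ = ⊥-elim (v≢x₃ v≡x₃)
        ... | no _     | no _     = refl

        outside′ : ∀ {v} → v ∉ S′ → v ≢ x₂ → v ≢ x₃ → v ∉ S
        outside′ {v} v∉S′ v≢x₂ v≢x₃ with v ≟ y
        ... | yes refl = y∉S
        ... | no v≢y   = outside v∉S′ (v≢x₂ , v≢x₃ , v≢y)

        label-adjacent : ∀ {u w} → u ∉ S′ → w ∉ S′ → Adjacent G u w → label u ≡ label w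
        label-adjacent u∉S′ w∉S′ uw =
          trans (label-other u≢x₂ u≢x₃)
            (trans (cong (λ d → suc (suc d))
                     (component-≡ zero u∉S w∉S (comp-adjacent-outside u∉S w∉S u∉S′ w∉S′ uw)))
                   (sym (label-other w≢x₂ w≢x₃)))
          where
          u≢x₂ = link-isolated link₂ w∉S′ uw
          u≢x₃ = link-isolated link₃ w∉S′ uw
          w≢x₂ = link-isolated link₂ u∉S′ (⊎-swap uw)
          w≢x₃ = link-isolated link₃ u∉S′ (⊎-swap uw)
          u∉S = outside′ u∉S′ u≢x₂ u≢x₃
          w∉S = outside′ w∉S′ w≢x₂ w≢x₃

        y∉S′ : y ∉ S′
        y∉S′ (here y≡b) = b≢y (sym y≡b)
        y∉S′ (there m)  = y∉S (proj₁ (∈-filter⁻ kept? {xs = S} m))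

        -- y keeps b's component of G⁻ - S visible
        label-onto : ∀ t → ∃[ v ] v ∉ S′ × label v ≡ t
        label-onto zero          = x₂ , x₂∉S′ , label-x₂
        label-onto (suc zero)    = x₃ , x₃∉S′ , label-x₃
        label-onto (suc (suc t)) with t Fin.≟ j | onto t
        ... | yes refl | _ =
          y , y∉S′ , trans (label-other (≢-sym x₂≢y) (≢-sym x₃≢y))
                       (cong (λ d → suc (suc d)) (trans (component-∉ zero y∉S) (comp-adjacent C y∉S b∉S y–b)))
        ... | no v≁b | v , v∉S , refl with v∉S′ , v≢x₂ , v≢x₃ ← off-b-component v∉S v≁b =
          v , v∉S′ , trans (label-other v≢x₂ v≢x₃) (cong (λ d → suc (suc d)) (component-∉ zero v∉S))

        bound : suc n ℕ.≤ length S ℕ.* 2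
        bound = ℕP.≤-trans
          (ℕP.≤-pred (ℕP.≤-pred (labelling-bound finite tough unique-S′
            record { label = label ; label-adjacent = label-adjacent ; label-onto = label-onto }
            (s≤s (s≤s z≤n)))))
          (ℕP.*-monoˡ-≤ 2 (length-filter kept? S))

      module CutY (y∈S : y ∈ S) where
        -- b's component of G⁻ - S may vanish with b, so x₃ carries its label
        label : V G → Fin (suc (suc n))
        label v with v ≟ x₂ | v ≟ x₃ | v ≟ y
        ... | yes _ | _     | _     = zero
        ... | no _  | yes _ | _     = suc j
        ... | no _  | no _  | yes _ = suc (component zero c)
        ... | no _  | no _  | no _  = suc (component zero v)

        label-x₂ : label x₂ ≡ zero
        label-x₂ with x₂ ≟ x₂
        ... | yes _    = refl
        ... | no x₂≢x₂ = ⊥-elim (x₂≢x₂ refl)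

        label-x₃ : label x₃ ≡ suc j
        label-x₃ with x₃ ≟ x₂ | x₃ ≟ x₃
        ... | yes x₃≡x₂ | _        = ⊥-elim (x₂≢x₃ (sym x₃≡x₂))
        ... | no _      | yes _    = refl
        ... | no _      | no x₃≢x₃ = ⊥-elim (x₃≢x₃ refl)

        label-y : label y ≡ suc (component zero c)
        label-y with y ≟ x₂ | y ≟ x₃ | y ≟ y
        ... | yes y≡x₂ | _        | _      = ⊥-elim (x₂≢y (sym y≡x₂))
        ... | no _     | yes y≡x₃ | _      = ⊥-elim (x₃≢y (sym y≡x₃))
        ... | no _     | no _     | yes _  = refl
        ... | no _     | no _     | no y≢y = ⊥-elim (y≢y refl)

        label-other : ∀ {v} → Kept v → label v ≡ suc (component zero v)
        label-other {v} (v≢x₂ , v≢x₃ , v≢y) with v ≟ x₂ | v ≟ x₃ | v ≟ y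
        ... | yes v≡x₂ | _        | _       = ⊥-elim (v≢x₂ v≡x₂)
        ... | no _     | yes v≡x₃ | _       = ⊥-elim (v≢x₃ v≡x₃)
        ... | no _     | no _     | yes v≡y = ⊥-elim (v≢y v≡y)
        ... | no _     | no _     | no _    = refl

        label-y-neighbour : ∀ {w} → w ∉ S′ → Adjacent G y w → label y ≡ label w
        label-y-neighbour w∉S′ yw with Link.neighbours link-y yw
        ... | inj₁ refl = ⊥-elim (w∉S′ (here refl))
        ... | inj₂ refl = trans label-y (sym (label-other (≢-sym x₂≢c , ≢-sym x₃≢c , ≢-sym y≢c)))

        label-adjacent′ : ∀ {u w} → Dec (u ≡ y) → Dec (w ≡ y) → u ∉ S′ → w ∉ S′ → Adjacent G u w →
                          label u ≡ label w
        label-adjacent′ (yes refl) _          u∉S′ w∉S′ uw = label-y-neighbour w∉S′ uw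
        label-adjacent′ (no _)     (yes refl) u∉S′ w∉S′ uw = sym (label-y-neighbour u∉S′ (⊎-swap uw))
        label-adjacent′ (no u≢y)   (no w≢y)   u∉S′ w∉S′ uw =
          trans (label-other u-kept)
            (trans (cong suc (component-≡ zero u∉S w∉S (comp-adjacent-outside u∉S w∉S u∉S′ w∉S′ uw)))
                   (sym (label-other w-kept)))
          where
          u-kept = link-isolated link₂ w∉S′ uw , link-isolated link₃ w∉S′ uw , u≢y
          w-kept = link-isolated link₂ u∉S′ (⊎-swap uw) , link-isolated link₃ u∉S′ (⊎-swap uw) , w≢y
          u∉S = outside u∉S′ u-kept
          w∉S = outside w∉S′ w-kept

        label-adjacent : ∀ {u w} → u ∉ S′ → w ∉ S′ → Adjacent G u w → label u ≡ label w
        label-adjacent {u} {w} = label-adjacent′ (u ≟ y) (w ≟ y)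

        label-onto : ∀ t → ∃[ v ] v ∉ S′ × label v ≡ t
        label-onto zero    = x₂ , x₂∉S′ , label-x₂
        label-onto (suc t) with t Fin.≟ j | onto t
        ... | yes refl | _ = x₃ , x₃∉S′ , label-x₃
        ... | no v≁b | v , v∉S , refl with v∉S′ , v≢x₂ , v≢x₃ ← off-b-component v∉S v≁b =
          v , v∉S′ , trans (label-other (v≢x₂ , v≢x₃ , λ { refl → v∉S y∈S })) (cong suc (component-∉ zero v∉S))

        bound : suc n ℕ.≤ length S ℕ.* 2
        bound = ℕP.≤-trans (ℕP.n≤1+n _) (ℕP.≤-trans
          (labelling-bound finite tough unique-S′
            record { label = label ; label-adjacent = label-adjacent ; label-onto = label-onto }
            (s≤s (s≤s z≤n)))
          (ℕP.*-monoˡ-≤ 2 (filter-notAll kept? S (Any.map (λ y≡v kept → proj₂ (proj₂ kept) (sym y≡v)) y∈S))))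

    bound : 1 ℕ.< suc n → suc n ℕ.≤ length S ℕ.* 2
    bound 1<k with b ∈? S | a ∈? S
    ... | yes b∈S | _ = joined-bound 1<k (λ _ b∉S → ⊥-elim (b∉S b∈S))
    ... | no b∉S | yes a∈S with y ∈? S
    ...   | yes y∈S = CutAtA.CutY.bound a∈S b∉S y∈S
    ...   | no y∉S  = CutAtA.KeepY.bound a∈S b∉S y∉S
    bound 1<k | no b∉S | no a∉S with comp a a∉S Fin.≟ comp b b∉S
    ... | no i≢j = Separated.bound a∉S b∉S i≢j
    ... | yes i≡j = joined-bound 1<k λ x₁∉S b∉S′ →
      trans (sym (comp-adjacent C a∉S x₁∉S a–x₁)) (trans i≡j (comp-irrelevant C b b∉S b∉S′))

  HalfTough-deleteEdge : HalfTough G → HalfTough G⁻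
  HalfTough-deleteEdge tough S U zero    C ()
  HalfTough-deleteEdge tough S U (suc n) C 1<k = Cut.bound tough U C 1<k

  ¬MinimallyTough½ : ¬ MinimallyTough G ½
  ¬MinimallyTough½ ((tough , _) , drop) with t , t<½ , _ , maximal ← drop (index x₁b) =
    ℚP.<-irrefl refl (ℚP.<-≤-trans t<½ (maximal ½ tough⁻))
    where
    tough⁻ : Tough G⁻ ½
    tough⁻ = Equivalence.from (Tough½⇔HalfTough G⁻)
               (HalfTough-deleteEdge (Equivalence.to (Tough½⇔HalfTough G) tough))

-- Locating R₃,₂ in a series–parallel graph

asGraph : TTGraph → Graph
asGraph H = record { V = Vtx (I H) ; E = Es H }

data Internal {J : Set} : Vtx J → Set where
  internal : ∀ i → Internal (int i)

record SourceLink (H : TTGraph) : Set where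
  field
    y c        : Vtx (I H)
    y-link     : Link (asGraph H) src y c
    y-internal : Internal y
    c≢src      : c ≢ src
    y≢c        : y ≢ c

record SPPattern (H : TTGraph) : Set where
  field
    underlying : Pattern (asGraph H)
  open Pattern underlying
  field
    x₁-internal : Internal x₁
    x₂-internal : Internal x₂
    x₃-internal : Internal x₃
    y-internal  : Internal y

record Embedding (A B : TTGraph) : Set where
  field
    vertex           : Vtx (I A) → Vtx (I B)
    vertex-injective : ∀ {u w} → vertex u ≡ vertex w → u ≡ w
    vertex-internal  : ∀ {v} → Internal v → Internal (vertex v)
    edge             : ∀ {u w} → (u , w) ∈ Es A → (vertex u , vertex w) ∈ Es B
    adjacent⁻        : ∀ {v w} → Internal v → Adjacent (asGraph B) (vertex v) w →
                       ∃[ w′ ] Adjacent (asGraph A) v w′ × w ≡ vertex w′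

  link : ∀ {p v q} → Internal v → Link (asGraph A) p v q → Link (asGraph B) (vertex p) (vertex v) (vertex q)
  link v-internal L = record
    { edge₁ = edge (Link.edge₁ L) ; edge₂ = edge (Link.edge₂ L)
    ; neighbours = λ vw → neighbours (adjacent⁻ v-internal vw) }
    where
    neighbours : ∀ {w} → ∃[ w′ ] Adjacent (asGraph A) _ w′ × w ≡ vertex w′ → w ≡ vertex _ ⊎ w ≡ vertex _
    neighbours (_ , vw′ , refl) = Sum.map (cong vertex) (cong vertex) (Link.neighbours L vw′)

  source-link : vertex src ≡ src → SourceLink A → SourceLink B
  source-link fixes-src L = record
    { y = vertex y ; c = vertex c
    ; y-link = subst (λ s → Link (asGraph B) s (vertex y) (vertex c)) fixes-src (link y-internal y-link)
    ; y-internal = vertex-internal y-internal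
    ; c≢src = λ c↦src → c≢src (vertex-injective (trans c↦src (sym fixes-src)))
    ; y≢c = y≢c ∘ vertex-injective }
    where open SourceLink L

  sp-pattern : SPPattern A → SPPattern B
  sp-pattern P = record
    { underlying = record
      { a = vertex a ; b = vertex b ; x₁ = vertex x₁ ; x₂ = vertex x₂ ; x₃ = vertex x₃
      ; y = vertex y ; c = vertex c
      ; link₁ = link x₁-internal link₁ ; link₂ = link x₂-internal link₂ ; link₃ = link x₃-internal link₃
      ; link-y = link y-internal link-y ; distinct = Unique.map⁺ vertex-injective distinct }
    ; x₁-internal = vertex-internal x₁-internal ; x₂-internal = vertex-internal x₂-internal
    ; x₃-internal = vertex-internal x₃-internal ; y-internal = vertex-internal y-internal }
    where
    open SPPattern P
    open Pattern underlying

id-embedding : ∀ {A} → Embedding A A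
id-embedding = record
  { vertex = λ v → v ; vertex-injective = λ eq → eq ; vertex-internal = λ v-internal → v-internal
  ; edge = λ e → e ; adjacent⁻ = λ _ vw → _ , vw , refl }

_∘ᴱ_ : ∀ {A B C} → Embedding B C → Embedding A B → Embedding A C
g ∘ᴱ f = record
  { vertex = G.vertex ∘ F.vertex
  ; vertex-injective = F.vertex-injective ∘ G.vertex-injective
  ; vertex-internal = G.vertex-internal ∘ F.vertex-internal
  ; edge = G.edge ∘ F.edge
  ; adjacent⁻ = adjacent⁻ }
  where
  module F = Embedding f
  module G = Embedding g
  adjacent⁻ : ∀ {v w} → Internal v → Adjacent _ (G.vertex (F.vertex v)) w → ∃[ w′ ] Adjacent _ v w′ × w ≡ _
  adjacent⁻ v-internal vw with _ , vw₁ , refl ← G.adjacent⁻ (F.vertex-internal v-internal) vw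
                           with w₀ , vw₀ , refl ← F.adjacent⁻ v-internal vw₁ = w₀ , vw₀ , refl

module _ {J K : Set} (φ : Vtx J → Vtx K) (ι : J → K) (φ-int : ∀ i → φ (int i) ≡ int (ι i))
         (ι-injective : ∀ {i j} → ι i ≡ ι j → i ≡ j) (src≢tgt : φ src ≢ φ tgt)
         (src∉ι : ∀ i → φ src ≢ int (ι i)) (tgt∉ι : ∀ i → φ tgt ≢ int (ι i)) where

  Vtx-injective : ∀ {u w} → φ u ≡ φ w → u ≡ w
  Vtx-injective {src}   {src}   _  = refl
  Vtx-injective {src}   {tgt}   eq = ⊥-elim (src≢tgt eq)
  Vtx-injective {src}   {int j} eq = ⊥-elim (src∉ι j (trans eq (φ-int j)))
  Vtx-injective {tgt}   {src}   eq = ⊥-elim (src≢tgt (sym eq))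
  Vtx-injective {tgt}   {tgt}   _  = refl
  Vtx-injective {tgt}   {int j} eq = ⊥-elim (tgt∉ι j (trans eq (φ-int j)))
  Vtx-injective {int i} {src}   eq = ⊥-elim (src∉ι i (trans (sym eq) (φ-int i)))
  Vtx-injective {int i} {tgt}   eq = ⊥-elim (tgt∉ι i (trans (sym eq) (φ-int i)))
  Vtx-injective {int i} {int j} eq =
    cong int (ι-injective (int-injective (trans (sym (φ-int i)) (trans eq (φ-int j)))))
    where
    int-injective : ∀ {k l : K} → int k ≡ int l → k ≡ l
    int-injective refl = refl

module _ {A B : TTGraph} (f : Vtx (I A) → Vtx (I B))
         (f-injective : ∀ {u w} → f u ≡ f w → u ≡ w) (f-internal : ∀ i → Internal (f (int i))) where

  image⁻ˡ : ∀ {v w} → (f v , w) ∈ mapE f (Es A) → ∃[ w′ ] (v , w′) ∈ Es A × w ≡ f w′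
  image⁻ˡ m with (u′ , w′) , m′ , eq ← ∈-map⁻ _ m with refl ← f-injective (,-injectiveˡ eq) =
    w′ , m′ , ,-injectiveʳ eq

  image⁻ʳ : ∀ {v w} → (w , f v) ∈ mapE f (Es A) → ∃[ w′ ] (w′ , v) ∈ Es A × w ≡ f w′
  image⁻ʳ m with (u′ , w′) , m′ , eq ← ∈-map⁻ _ m with refl ← f-injective (,-injectiveʳ eq) =
    u′ , m′ , ,-injectiveˡ eq

  Avoids : Vtx (I B) → Set
  Avoids u = ∀ i → u ≢ f (int i)

  embedding : (∀ {u w} → (u , w) ∈ Es A → (f u , f w) ∈ Es B) →
              (∀ {u w} → (u , w) ∈ Es B → (u , w) ∈ mapE f (Es A) ⊎ Avoids u × Avoids w) → Embedding A B
  embedding edge split = record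
    { vertex = f ; vertex-injective = f-injective
    ; vertex-internal = λ { (internal i) → f-internal i } ; edge = edge ; adjacent⁻ = adjacent⁻ }
    where
    adjacent⁻ : ∀ {v w} → Internal v → Adjacent (asGraph B) (f v) w →
                ∃[ w′ ] Adjacent (asGraph A) v w′ × w ≡ f w′
    adjacent⁻ (internal i) (inj₁ vw) with split vw
    ... | inj₁ m = let w′ , m′ , eq = image⁻ˡ m in w′ , inj₁ m′ , eq
    ... | inj₂ (avoids , _) = ⊥-elim (avoids i refl)
    adjacent⁻ (internal i) (inj₂ wv) with split wv
    ... | inj₁ m = let w′ , m′ , eq = image⁻ʳ m in w′ , inj₂ m′ , eq
    ... | inj₂ (_ , avoids) = ⊥-elim (avoids i refl)

  module _ {H : TTGraph} (g : Vtx (I H) → Vtx (I B)) (g-avoids : ∀ v → Avoids (g v)) where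

    avoids : ∀ {u w} → (u , w) ∈ mapE g (Es H) → Avoids u × Avoids w
    avoids m with (u′ , w′) , _ , refl ← ∈-map⁻ _ m = g-avoids u′ , g-avoids w′

    embeddingˡ : Es B ≡ mapE f (Es A) ++ mapE g (Es H) → Embedding A B
    embeddingˡ refl = embedding (∈-++⁺ˡ ∘ ∈-map⁺ _) (Sum.map₂ avoids ∘ ∈-++⁻ (mapE f (Es A)))

    embeddingʳ : Es B ≡ mapE g (Es H) ++ mapE f (Es A) → Embedding A B
    embeddingʳ refl =
      embedding (∈-++⁺ʳ (mapE g (Es H)) ∘ ∈-map⁺ _) (Sum.[ inj₂ ∘ avoids , inj₁ ] ∘ ∈-++⁻ (mapE g (Es H)))

-- The vertex maps of ser2 and par2 are local to their where-blocks; unification recovers them.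
ser2-maps : ∀ A H → Σ (Vtx (I A) → Vtx (I (ser2 A H))) λ f → Σ (Vtx (I H) → Vtx (I (ser2 A H))) λ g →
            Es (ser2 A H) ≡ mapE f (Es A) ++ mapE g (Es H)
ser2-maps A H = _ , _ , refl

par2-maps : ∀ A H → Σ (Vtx (I A) → Vtx (I (par2 A H))) λ f → Σ (Vtx (I H) → Vtx (I (par2 A H))) λ g →
            Es (par2 A H) ≡ mapE f (Es A) ++ mapE g (Es H)
par2-maps A H = _ , _ , refl

module _ (A H : TTGraph) where
  private
    sf = proj₁ (ser2-maps A H)
    sg = proj₁ (proj₂ (ser2-maps A H))
    pf = proj₁ (par2-maps A H)
    pg = proj₁ (proj₂ (par2-maps A H))

  ser-left : Embedding A (ser2 A H)
  ser-left = embeddingˡ sf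
    (Vtx-injective sf inj₁ (λ _ → refl) (λ { refl → refl }) (λ ()) (λ _ ()) (λ _ ()))
    (λ _ → internal _) sg (λ { src _ () ; tgt _ () ; (int _) _ () }) refl

  ser-right : Embedding H (ser2 A H)
  ser-right = embeddingʳ sg
    (Vtx-injective sg (inj₂ ∘ inj₁) (λ _ → refl) (λ { refl → refl }) (λ ()) (λ _ ()) (λ _ ()))
    (λ _ → internal _) sf (λ { src _ () ; tgt _ () ; (int _) _ () }) refl

  par-left : Embedding A (par2 A H)
  par-left = embeddingˡ pf
    (Vtx-injective pf inj₁ (λ _ → refl) (λ { refl → refl }) (λ ()) (λ _ ()) (λ _ ()))
    (λ _ → internal _) pg (λ { src _ () ; tgt _ () ; (int _) _ () }) refl

  par-right : Embedding H (par2 A H)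
  par-right = embeddingʳ pg
    (Vtx-injective pg inj₂ (λ _ → refl) (λ { refl → refl }) (λ ()) (λ _ ()) (λ _ ()))
    (λ _ → internal _) pf (λ { src _ () ; tgt _ () ; (int _) _ () }) refl

module Children (join : TTGraph → List SPTree → TTGraph)
                (first : ∀ G cs → Embedding G (join G cs))
                (rest : ∀ G c cs → Embedding (join (spGraph c) cs) (join G (c ∷ cs))) where

  suffix : ∀ G pre d ds → Embedding (join (spGraph d) ds) (join G (pre ++ d ∷ ds))
  suffix G []        d ds = rest G d ds
  suffix G (p ∷ pre) d ds = rest G p (pre ++ d ∷ ds) ∘ᴱ suffix (spGraph p) pre d ds

  member : ∀ {c cs d} → d ∈ c ∷ cs → Embedding (spGraph d) (join (spGraph c) cs)
  member {c} {cs} (here refl) = first (spGraph c) cs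
  member {c} (there d∈cs) with pre , post , refl ← ∈-∃++ d∈cs = suffix (spGraph c) pre _ post ∘ᴱ first _ post

serList-first : ∀ G cs → Embedding G (serList G cs)
serList-first G []       = id-embedding
serList-first G (c ∷ cs) = ser-left G (serList (spGraph c) cs)

parList-first : ∀ G cs → Embedding G (parList G cs)
parList-first G []       = id-embedding
parList-first G (c ∷ cs) = par-left G (parList (spGraph c) cs)

module Ser = Children serList serList-first (λ G c cs → ser-right G (serList (spGraph c) cs))
module Par = Children parList parList-first (λ G c cs → par-right G (parList (spGraph c) cs))

P₂-middle : Vtx (I (spGraph P₂))
P₂-middle = int (inj₂ (inj₂ tt))

P₂-link : Link (asGraph (spGraph P₂)) src P₂-middle tgt
P₂-link = record { edge₁ = here refl ; edge₂ = there (here refl) ; neighbours = neighbours }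
  where
  neighbours : ∀ {w} → Adjacent (asGraph (spGraph P₂)) P₂-middle w → w ≡ src ⊎ w ≡ tgt
  neighbours (inj₁ (there (here refl))) = inj₂ refl
  neighbours (inj₂ (here refl))         = inj₁ refl
  neighbours (inj₁ (here ()))
  neighbours (inj₁ (there (there ())))
  neighbours (inj₂ (there (here ())))
  neighbours (inj₂ (there (there ())))

R₂-source-link : SourceLink (spGraph R₂)
R₂-source-link = record
  { y = _ ; c = tgt ; y-link = Embedding.link (par-left P P) (internal _) P₂-link
  ; y-internal = internal _ ; c≢src = λ () ; y≢c = λ () }
  where P = spGraph P₂

serList-source-link : ∀ post → SourceLink (serList (spGraph R₂) post)
serList-source-link []       = R₂-source-link
serList-source-link (p ∷ ps) = Embedding.source-link (ser-left _ (serList (spGraph p) ps)) refl R₂-source-link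

module _ (X : TTGraph) where
  private
    P  = spGraph P₂
    R₃G = spGraph R₃
    L = ser-left R₃G X
    R = ser-right R₃G X
    copy₁ : Embedding P R₃G
    copy₁ = par-left P (par2 P P)
    copy₂ : Embedding P R₃G
    copy₂ = par-right P (par2 P P) ∘ᴱ par-left P P
    copy₃ : Embedding P R₃G
    copy₃ = par-right P (par2 P P) ∘ᴱ par-right P P
    link : ∀ {i} → Link (asGraph R₃G) src (int i) tgt →
           Link (asGraph (ser2 R₃G X)) src _ (Embedding.vertex L tgt)
    link = Embedding.link L (internal _)

  R₃-pattern : SourceLink X → SPPattern (ser2 R₃G X)
  R₃-pattern Y = record
    { underlying = record
      { link₁ = link (Embedding.link copy₁ (internal _) P₂-link)
      ; link₂ = link (Embedding.link copy₂ (internal _) P₂-link)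
      ; link₃ = link (Embedding.link copy₃ (internal _) P₂-link)
      ; link-y = Embedding.link R y-internal y-link
      ; distinct = distinct y-internal c≢src y≢c }
    ; x₁-internal = internal _ ; x₂-internal = internal _ ; x₃-internal = internal _
    ; y-internal = Embedding.vertex-internal R y-internal }
    where
    open SourceLink Y
    open Embedding R using (vertex; vertex-injective)
    distinct : ∀ {y c} → Internal y → c ≢ src → y ≢ c →
               Unique (src ∷ vertex src ∷ _ ∷ _ ∷ _ ∷ vertex y ∷ vertex c ∷ [])
    distinct {c = src} _ c≢src _ = ⊥-elim (c≢src refl)
    distinct {c = tgt} (internal _) _ _ =
      ((λ ()) ∷ (λ ()) ∷ (λ ()) ∷ (λ ()) ∷ (λ ()) ∷ (λ ()) ∷ []) ∷
      ((λ ()) ∷ (λ ()) ∷ (λ ()) ∷ (λ ()) ∷ (λ ()) ∷ []) ∷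
      ((λ ()) ∷ (λ ()) ∷ (λ ()) ∷ (λ ()) ∷ []) ∷
      ((λ ()) ∷ (λ ()) ∷ (λ ()) ∷ []) ∷
      ((λ ()) ∷ (λ ()) ∷ []) ∷
      ((λ ()) ∷ []) ∷ [] ∷ []
    distinct {c = int _} (internal _) _ y≢c =
      ((λ ()) ∷ (λ ()) ∷ (λ ()) ∷ (λ ()) ∷ (λ ()) ∷ (λ ()) ∷ []) ∷
      ((λ ()) ∷ (λ ()) ∷ (λ ()) ∷ (λ ()) ∷ (λ ()) ∷ []) ∷
      ((λ ()) ∷ (λ ()) ∷ (λ ()) ∷ (λ ()) ∷ []) ∷
      ((λ ()) ∷ (λ ()) ∷ (λ ()) ∷ []) ∷
      ((λ ()) ∷ (λ ()) ∷ []) ∷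
      ((y≢c ∘ vertex-injective) ∷ []) ∷ [] ∷ []

mutual
  r32-pattern : ∀ {T} → ContainsR32 T → SPPattern (spGraph T)
  r32-pattern (atRoot []        post) = R₃-pattern _ (serList-source-link post)
  r32-pattern (atRoot (p ∷ pre) post) =
    Embedding.sp-pattern (Ser.suffix (spGraph p) pre R₃ (R₂ ∷ post)) (R₃-pattern _ (serList-source-link post))
  r32-pattern (inSer {[]}    ())
  r32-pattern (inSer {_ ∷ _} h) with _ , d∈cs , P ← find (r32-patterns h) =
    Embedding.sp-pattern (Ser.member d∈cs) P
  r32-pattern (inPar {[]}    ())
  r32-pattern (inPar {_ ∷ _} h) with _ , d∈cs , P ← find (r32-patterns h) =
    Embedding.sp-pattern (Par.member d∈cs) P

  r32-patterns : ∀ {cs} → Any ContainsR32 cs → Any (SPPattern ∘ spGraph) cs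
  r32-patterns (here h)  = here (r32-pattern h)
  r32-patterns (there h) = there (r32-patterns h)

finite-⊥ : Finite ⊥
finite-⊥ = record { _≟_ = λ () ; elements = [] ; complete = λ () }

finite-⊤ : Finite ⊤
finite-⊤ = record { _≟_ = ⊤._≟_ ; elements = tt ∷ [] ; complete = λ _ → here refl }

finite-⊎ : ∀ {A B} → Finite A → Finite B → Finite (A ⊎ B)
finite-⊎ FA FB = record
  { _≟_ = Sum.≡-dec (Finite._≟_ FA) (Finite._≟_ FB)
  ; elements = map inj₁ (Finite.elements FA) ++ map inj₂ (Finite.elements FB)
  ; complete = λ { (inj₁ a) → ∈-++⁺ˡ (∈-map⁺ inj₁ (Finite.complete FA a))
                 ; (inj₂ b) → ∈-++⁺ʳ _ (∈-map⁺ inj₂ (Finite.complete FB b)) } }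

finite-Vtx : ∀ {J} → Finite J → Finite (Vtx J)
finite-Vtx {J} FJ = record { _≟_ = _≟_ ; elements = src ∷ tgt ∷ map int elements ; complete = complete′ }
  where
  open Finite FJ renaming (_≟_ to _≟J_)
  _≟_ : DecidableEquality (Vtx J)
  src   ≟ src   = yes refl
  tgt   ≟ tgt   = yes refl
  int i ≟ int j with i ≟J j
  ... | yes refl = yes refl
  ... | no i≢j   = no λ { refl → i≢j refl }
  src   ≟ tgt   = no λ ()
  src   ≟ int _ = no λ ()
  tgt   ≟ src   = no λ ()
  tgt   ≟ int _ = no λ ()
  int _ ≟ src   = no λ ()
  int _ ≟ tgt   = no λ ()
  complete′ : ∀ v → v ∈ src ∷ tgt ∷ map int elements
  complete′ src     = here refl
  complete′ tgt     = there (here refl)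
  complete′ (int i) = there (there (∈-map⁺ int (complete i)))

mutual
  finite-spGraph : ∀ T → Finite (I (spGraph T))
  finite-spGraph leaf           = finite-⊥
  finite-spGraph (ser [])       = finite-⊥
  finite-spGraph (ser (c ∷ cs)) = finite-serList (finite-spGraph c) cs
  finite-spGraph (par [])       = finite-⊥
  finite-spGraph (par (c ∷ cs)) = finite-parList (finite-spGraph c) cs

  finite-serList : ∀ {G} → Finite (I G) → ∀ cs → Finite (I (serList G cs))
  finite-serList FG []       = FG
  finite-serList FG (c ∷ cs) = finite-⊎ FG (finite-⊎ (finite-serList (finite-spGraph c) cs) finite-⊤)

  finite-parList : ∀ {G} → Finite (I G) → ∀ cs → Finite (I (parList G cs))
  finite-parList FG []       = FG
  finite-parList FG (c ∷ cs) = finite-⊎ FG (finite-parList (finite-spGraph c) cs)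

lemma4p9 : (T : SPTree) → WF T → ContainsR32 T → ¬ MinimallyTough (graphOf T) ½
lemma4p9 T _ contains =
  ¬MinimallyTough½ (finite-Vtx (finite-spGraph T)) (SPPattern.underlying (r32-pattern contains))
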